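{- Let $AL$ be the set of alternating permutations, $BR$ the set of permutations beginning with a rise (permutations $\pi$ of length at least $2$ with $\pi(1)<\pi(2)$), $ER$ the set of permutations ending with a rise (permutations $\pi$ of length $n\ge 2$ with $\pi(n-1)<\pi(n)$), and $\{1\}$ the set consisting only of the permutation of length $1$. Then the set of properties $\{AL, BR, ER, \{1\}\}$ is query-complete.
   Context: Permutations are written in one-line notation $\pi=\pi(1)\pi(2)\cdots\pi(n)$. An interval of a permutation $\pi$ is a set of contiguous positions $[a,b]$ whose set of values $\{\pi(i): a\le i\le b\}$ is also a set of contiguous integers. A permutation of length $n$ is simple if its only intervals have lengths $0$, $1$ or $n$. Given a permutation $\sigma$ of length $m$ and nonempty permutations $\alpha_1,\dots,\alpha_m$, the inflation $\sigma[\alpha_1,\dots,\alpha_m]$ is the permutation obtained by replacing each entry $\sigma(i)$ by an interval whose entries are order isomorphic to $\alpha_i$ (so that the intervals appear left to right in the order $i=1,\dots,m$ and their relative vertical order is that of the entries of $\sigma$); e.g. $2413[1,132,321,12]=479832156$. A permutation $\pi$ of length $n$ is alternating if for all $i\in[2,n-1]$, $\pi(i)$ does not lie between $\pi(i-1)$ and $\pi(i+1)$. A property is any set $P$ of permutations; a permutation $\pi$ satisfies $P$ if $\pi\in P$. A set $\mathcal{P}$ of properties is query-complete if for every simple permutation $\sigma$ (of length $m$) and every property $P\in\mathcal{P}$, whether $\sigma[\alpha_1,\dots,\alpha_m]$ satisfies $P$ can be determined knowing only $\sigma$ and, for each $i$, which properties of $\mathcal{P}$ the permutation $\alpha_i$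 satisfies (equivalently: if for every $i$ the permutations $\alpha_i$ and $\alpha_i'$ satisfy exactly the same properties in $\mathcal{P}$, then $\sigma[\alpha_1,\dots,\alpha_m]\in P$ iff $\sigma[\alpha_1',\dots,\alpha_m']\in P$). -}

module Defs where

open import Data.Nat using (ℕ; zero; suc; _+_; _∸_; _≤_; _<_; _<ᵇ_)
open import Data.Bool using (if_then_else_)
open import Data.Nat.ListAction using (sum)
open import Data.Fin using (Fin)
open import Data.List using (List; []; _∷_; length; take; drop; map; concat; allFin; lookup; upTo)
open import Data.List.Membership.Propositional using (_∈_)
open import Data.List.Relation.Binary.Permutation.Propositional using (_↭_)
open import Data.Vec using (Vec) renaming ([] to []ᵥ; _∷_ to _∷ᵥ_)
import Data.Vec as Vec
open import Data.Product using (Σ; ∃; _×_)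
open import Data.Sum using (_⊎_)
open import Data.Empty using (⊥)
open import Data.Unit using (⊤)
open import Relation.Nullary using (¬_)
open import Relation.Binary.PropositionalEquality using (_≡_; _≢_)
open import Function.Bundles using (_⇔_)

-- Convention: a permutation of length n is written in one-line notation as a
-- list of natural numbers which is a rearrangement of 0,1,...,n-1
-- (values are shifted down by one compared to the paper's 1..n).
IsPerm : List ℕ → Set
IsPerm π = π ↭ upTo (length π)

Property : Set₁
Property = List ℕ → Set

IsInterval : List ℕ → ℕ → ℕ → Set
IsInterval π a len =
  (a + len ≤ length π) ×
  ∃ λ c → ∀ v → (v ∈ take len (drop a π)) ⇔ ((c ≤ v) × (v < c + len))

Simple : List ℕ → Set
Simple π = ∀ a len → IsInterval π a len → (len ≡ 0 ⊎ len ≡ 1) ⊎ len ≡ length π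

-- Inflation σ[α_1,...,α_m]: the block of α_i is shifted up by the total size of the
-- blocks α_k with σ(k) < σ(i), and blocks are concatenated left to right.
offset : (σ : List ℕ) → (Fin (length σ) → List ℕ) → Fin (length σ) → ℕ
offset σ α i =
  sum (map (λ k → if lookup σ k <ᵇ lookup σ i then length (α k) else 0) (allFin (length σ)))

inflate : (σ : List ℕ) → (Fin (length σ) → List ℕ) → List ℕ
inflate σ α = concat (map (λ i → map (λ v → v + offset σ α i) (α i)) (allFin (length σ)))

Between : ℕ → ℕ → ℕ → Set
Between x y z = ((x < y) × (y < z)) ⊎ ((z < y) × (y < x))

AL : Property
AL (x ∷ y ∷ z ∷ r) = ¬ Between x y z × AL (y ∷ z ∷ r)
AL _ = ⊤

BR : Property
BR (x ∷ y ∷ _) = x < y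
BR _ = ⊥

ER : Property
ER (x ∷ y ∷ []) = x < y
ER (x ∷ y ∷ z ∷ r) = ER (y ∷ z ∷ r)
ER _ = ⊥

One : Property
One π = π ≡ 0 ∷ []

QueryComplete : {k : ℕ} → (Fin k → Property) → Set
QueryComplete {k} P =
  (σ : List ℕ) → IsPerm σ → Simple σ →
  (α α' : Fin (length σ) → List ℕ) →
  (∀ i → IsPerm (α i) × (α i ≢ [])) →
  (∀ i → IsPerm (α' i) × (α' i ≢ [])) →
  (∀ i j → P j (α i) ⇔ P j (α' i)) →
  ∀ j → P j (inflate σ α) ⇔ P j (inflate σ α')

ALBRER1 : Fin 4 → Property
ALBRER1 = Vec.lookup (AL ∷ᵥ BR ∷ᵥ ER ∷ᵥ One ∷ᵥ []ᵥ)

-- Write down, for each adjacent pair of a permutation, whether it is a rise.  Membership in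
-- AL, BR, ER and {1} depends only on four features of this rise word: whether it is empty,
-- its first and last letters, and whether it alternates.  In an inflation σ[α₁,…,αₘ] the
-- block of αᵢ lies entirely below or entirely above the block of αᵢ₊₁, according as
-- σ(i) < σ(i+1) or not, so the rise word of the inflation is the rise words of the αᵢ glued
-- together by the letters of the rise word of σ, and the four features of a glued word are
-- computed from those of its pieces.
module Submission where

open import Defs
open import Data.Bool using (Bool; true; false; T; if_then_else_; _∧_; _∨_; _xor_)
open import Data.Bool.Properties using (∧-assoc; T-∧)
open import Data.Empty using (⊥-elim)
open import Data.Fin using (Fin; zero; suc; inject₁)
open import Data.List using (List; []; _∷_; _++_; length; map; concat; tabulate; lookup; null; head; last)
open import Data.List.Membership.Propositional using (_∈_)
open import Data.List.Membership.Propositional.Properties using (∈-map⁻; ∈-upTo⁻; ∈-allFin)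
open import Data.List.Properties using (map-tabulate; ++-identityʳ; map-cong; map-id)
open import Data.List.Relation.Binary.Permutation.Propositional using (↭-sym; ↭⇒↭ₛ)
open import Data.List.Relation.Binary.Permutation.Propositional.Properties using (∈-resp-↭)
import Data.List.Relation.Binary.Permutation.Setoid.Properties as Setoid↭
open import Data.List.Relation.Unary.Any using (here; there)
open import Data.List.Relation.Unary.Linked using (Linked; []; [-]; _∷_)
import Data.List.Relation.Unary.Linked as Linked
open import Data.List.Relation.Unary.Linked.Properties using (AllPairs⇒Linked; ++⁺; map⁺)
open import Data.List.Relation.Unary.Unique.Propositional.Properties using (upTo⁺)
open import Data.Maybe using (just)
open import Data.Maybe.Relation.Binary.Connected using (Connected; just)
open import Data.Nat using (ℕ; zero; suc; _+_; _≤_; _<_; _<ᵇ_; _<?_; z≤n)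
open import Data.Nat.ListAction using (sum)
open import Data.Nat.Properties
open import Algebra.Properties.CommutativeSemigroup +-commutativeSemigroup using (x∙yz≈y∙xz)
open import Data.Product using (∃; _×_; _,_; proj₁; proj₂)
open import Data.Product.Function.NonDependent.Propositional using (_×-⇔_)
open import Data.Sum using (inj₁; inj₂; [_,_])
open import Data.Unit using (tt)
open import Function using (_∘_)
open import Function.Bundles using (_⇔_; mk⇔; Equivalence)
open import Function.Construct.Composition using (_⇔-∘_)
open import Function.Construct.Identity using (⇔-id)
open import Function.Construct.Symmetry using (⇔-sym)
open import Relation.Binary.PropositionalEquality using (_≡_; _≢_; refl; sym; trans; cong; cong₂; subst; subst₂; ≢-sym; setoid; module ≡-Reasoning)
open import Relation.Nullary using (¬_)
open import Relation.Nullary.Decidable using (dec-true; dec-false)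
open import Relation.Nullary.Reflects using (ofʸ; ofⁿ)

T-injective : ∀ {a b} → (T a ⇔ T b) → a ≡ b
T-injective {false} {false} _ = refl
T-injective {false} {true} a⇔b = ⊥-elim (Equivalence.from a⇔b tt)
T-injective {true} {false} a⇔b = ⊥-elim (Equivalence.to a⇔b tt)
T-injective {true} {true} _ = refl

<ᵇ-irrefl : ∀ n → (n <ᵇ n) ≡ false
<ᵇ-irrefl n = dec-false (n <? n) (n≮n n)

<ᵇ-+ʳ : ∀ c x y → (x + c <ᵇ y + c) ≡ (x <ᵇ y)
<ᵇ-+ʳ c x y = T-injective (mk⇔ (<⇒<ᵇ ∘ +-cancelʳ-< c x y ∘ <ᵇ⇒< _ _) (<⇒<ᵇ ∘ +-monoˡ-< c ∘ <ᵇ⇒< x y))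

head-++ : ∀ {x} (xs ys : List ℕ) → head xs ≡ just x → head (xs ++ ys) ≡ just x
head-++ (_ ∷ _) _ refl = refl

last-∷ : ∀ (x : ℕ) xs → ∃ λ z → last (x ∷ xs) ≡ just z × z ∈ x ∷ xs
last-∷ x [] = x , refl , here refl
last-∷ x (y ∷ ys) with last-∷ y ys
... | z , eq , z∈ = z , eq , there z∈

map-≢[] : ∀ (f : ℕ → ℕ) {xs} → xs ≢ [] → map f xs ≢ []
map-≢[] f {[]} xs≢[] = ⊥-elim (xs≢[] refl)
map-≢[] f {_ ∷ _} _ ()

Linked-lookup : ∀ {A : Set} {R : A → A → Set} {x xs} → Linked R (x ∷ xs) →
  ∀ (i : Fin (length xs)) → R (lookup (x ∷ xs) (inject₁ i)) (lookup (x ∷ xs) (suc i))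
Linked-lookup (r ∷ _) zero = r
Linked-lookup (_ ∷ rs) (suc i) = Linked-lookup rs i

IsPerm⇒Linked≢ : ∀ {π} → IsPerm π → Linked _≢_ π
IsPerm⇒Linked≢ {π} π↭ =
  AllPairs⇒Linked (Setoid↭.Unique-resp-↭ (setoid ℕ) (↭⇒↭ₛ (↭-sym π↭)) (upTo⁺ (length π)))

IsPerm⇒<length : ∀ {π x} → IsPerm π → x ∈ π → x < length π
IsPerm⇒<length π↭ x∈π = ∈-upTo⁻ (∈-resp-↭ π↭ x∈π)

rises : List ℕ → List Bool
rises (x ∷ y ∷ r) = (x <ᵇ y) ∷ rises (y ∷ r)
rises _ = []

rises-++ : ∀ {x y} (xs ys : List ℕ) → last xs ≡ just x → head ys ≡ just y →
  rises (xs ++ ys) ≡ rises xs ++ (x <ᵇ y) ∷ rises ys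
rises-++ (_ ∷ []) (_ ∷ _) refl refl = refl
rises-++ (x ∷ x′ ∷ xs) ys lx hy = cong ((x <ᵇ x′) ∷_) (rises-++ (x′ ∷ xs) ys lx hy)

rises-shift : ∀ c xs → rises (map (_+ c) xs) ≡ rises xs
rises-shift c [] = refl
rises-shift c (_ ∷ []) = refl
rises-shift c (x ∷ y ∷ r) = cong₂ _∷_ (<ᵇ-+ʳ c x y) (rises-shift c (y ∷ r))

Linked≢-shift : ∀ c {xs} → Linked _≢_ xs → Linked _≢_ (map (_+ c) xs)
Linked≢-shift c = map⁺ ∘ Linked.map (λ x≢y → x≢y ∘ +-cancelʳ-≡ c _ _)

firstLetter : List Bool → Bool
firstLetter [] = false
firstLetter (a ∷ _) = a

lastLetter : List Bool → Bool
lastLetter [] = false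
lastLetter (a ∷ []) = a
lastLetter (_ ∷ b ∷ w) = lastLetter (b ∷ w)

alternating : List Bool → Bool
alternating (a ∷ b ∷ w) = (a xor b) ∧ alternating (b ∷ w)
alternating _ = true

record Profile : Set where
  constructor ⟨_,_,_,_⟩
  field
    isEmpty first final alternates : Bool

⟨⟩-cong : ∀ {a a′ b b′ c c′ d d′} → a ≡ a′ → b ≡ b′ → c ≡ c′ → d ≡ d′ →
  ⟨ a , b , c , d ⟩ ≡ ⟨ a′ , b′ , c′ , d′ ⟩
⟨⟩-cong refl refl refl refl = refl

profile : List Bool → Profile
profile w = ⟨ null w , firstLetter w , lastLetter w , alternating w ⟩

glue : Profile → Bool → Profile → Profile
glue p d q = ⟨ false
             , (if isEmpty p then d else first p)
             , (if isEmpty q then d else final q)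
             , (isEmpty p ∨ (alternates p ∧ (final p xor d))) ∧ ((isEmpty q ∨ (d xor first q)) ∧ alternates q)
             ⟩
  where open Profile

null-++-∷ : ∀ (u : List Bool) d v → null (u ++ d ∷ v) ≡ false
null-++-∷ [] _ _ = refl
null-++-∷ (_ ∷ _) _ _ = refl

firstLetter-++-∷ : ∀ u d v → firstLetter (u ++ d ∷ v) ≡ (if null u then d else firstLetter u)
firstLetter-++-∷ [] _ _ = refl
firstLetter-++-∷ (_ ∷ _) _ _ = refl

lastLetter-++-∷ : ∀ u d v → lastLetter (u ++ d ∷ v) ≡ (if null v then d else lastLetter v)
lastLetter-++-∷ [] _ [] = refl
lastLetter-++-∷ [] _ (_ ∷ _) = refl
lastLetter-++-∷ (_ ∷ []) d v = lastLetter-++-∷ [] d v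
lastLetter-++-∷ (_ ∷ b ∷ u) d v = lastLetter-++-∷ (b ∷ u) d v

alternating-∷ : ∀ d v → alternating (d ∷ v) ≡ (null v ∨ (d xor firstLetter v)) ∧ alternating v
alternating-∷ _ [] = refl
alternating-∷ _ (_ ∷ _) = refl

alternating-++-∷ : ∀ u d v →
  alternating (u ++ d ∷ v) ≡ (null u ∨ (alternating u ∧ (lastLetter u xor d))) ∧ alternating (d ∷ v)
alternating-++-∷ [] _ _ = refl
alternating-++-∷ (_ ∷ []) _ _ = refl
alternating-++-∷ (a ∷ b ∷ u) d v = begin
  (a xor b) ∧ alternating (b ∷ u ++ d ∷ v)
    ≡⟨ cong ((a xor b) ∧_) (alternating-++-∷ (b ∷ u) d v) ⟩
  (a xor b) ∧ ((alternating (b ∷ u) ∧ (lastLetter (b ∷ u) xor d)) ∧ rest)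
    ≡⟨ ∧-assoc (a xor b) _ rest ⟨
  ((a xor b) ∧ (alternating (b ∷ u) ∧ (lastLetter (b ∷ u) xor d))) ∧ rest
    ≡⟨ cong (_∧ rest) (∧-assoc (a xor b) _ _) ⟨
  (((a xor b) ∧ alternating (b ∷ u)) ∧ (lastLetter (b ∷ u) xor d)) ∧ rest ∎
  where
  open ≡-Reasoning
  rest = alternating (d ∷ v)

profile-++-∷ : ∀ u d v → profile (u ++ d ∷ v) ≡ glue (profile u) d (profile v)
profile-++-∷ u d v =
  ⟨⟩-cong (null-++-∷ u d v) (firstLetter-++-∷ u d v) (lastLetter-++-∷ u d v)
          (trans (alternating-++-∷ u d v) (cong (_ ∧_) (alternating-∷ d v)))

interleave : ∀ {n} → (Fin (suc n) → List Bool) → (Fin n → Bool) → List Bool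
interleave {zero} w d = w zero
interleave {suc n} w d = w zero ++ d zero ∷ interleave (w ∘ suc) (d ∘ suc)

profile-interleave : ∀ {n} {w w′ : Fin (suc n) → List Bool} (d : Fin n → Bool) →
  (∀ i → profile (w i) ≡ profile (w′ i)) → profile (interleave w d) ≡ profile (interleave w′ d)
profile-interleave {zero} d same = same zero
profile-interleave {suc n} {w} {w′} d same = begin
  profile (w zero ++ d zero ∷ interleave (w ∘ suc) (d ∘ suc))
    ≡⟨ profile-++-∷ (w zero) (d zero) _ ⟩
  glue (profile (w zero)) (d zero) (profile (interleave (w ∘ suc) (d ∘ suc)))
    ≡⟨ cong₂ (λ p q → glue p (d zero) q) (same zero) (profile-interleave (d ∘ suc) (same ∘ suc)) ⟩
  glue (profile (w′ zero)) (d zero) (profile (interleave (w′ ∘ suc) (d ∘ suc)))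
    ≡⟨ profile-++-∷ (w′ zero) (d zero) _ ⟨
  profile (w′ zero ++ d zero ∷ interleave (w′ ∘ suc) (d ∘ suc)) ∎
  where open ≡-Reasoning

¬Between⇔xor : ∀ {x y z} → x ≢ y → y ≢ z → (¬ Between x y z) ⇔ T ((x <ᵇ y) xor (y <ᵇ z))
¬Between⇔xor {x} {y} {z} x≢y y≢z with x <ᵇ y | <ᵇ-reflects-< x y | y <ᵇ z | <ᵇ-reflects-< y z
... | true  | ofʸ x<y | true  | ofʸ y<z = mk⇔ (λ ¬b → ¬b (inj₁ (x<y , y<z))) λ ()
... | true  | ofʸ x<y | false | ofⁿ y≮z = mk⇔ _ λ _ → [ y≮z ∘ proj₂ , <-asym x<y ∘ proj₂ ]
... | false | ofⁿ x≮y | true  | ofʸ y<z = mk⇔ _ λ _ → [ x≮y ∘ proj₁ , <-asym y<z ∘ proj₁ ]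
... | false | ofⁿ x≮y | false | ofⁿ y≮z =
  mk⇔ (λ ¬b → ¬b (inj₂ (≤∧≢⇒< (≮⇒≥ y≮z) (≢-sym y≢z) , ≤∧≢⇒< (≮⇒≥ x≮y) (≢-sym x≢y)))) λ ()

AL⇔alternating : ∀ {π} → Linked _≢_ π → AL π ⇔ T (alternating (rises π))
AL⇔alternating [] = mk⇔ _ _
AL⇔alternating [-] = mk⇔ _ _
AL⇔alternating (_ ∷ [-]) = mk⇔ _ _
AL⇔alternating (x≢y ∷ l@(y≢z ∷ _)) =
  ⇔-sym T-∧ ⇔-∘ (¬Between⇔xor x≢y y≢z ×-⇔ AL⇔alternating l)

BR⇔firstLetter : ∀ π → BR π ⇔ T (firstLetter (rises π))
BR⇔firstLetter [] = mk⇔ (λ ()) (λ ())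
BR⇔firstLetter (_ ∷ []) = mk⇔ (λ ()) (λ ())
BR⇔firstLetter (x ∷ y ∷ _) = mk⇔ <⇒<ᵇ (<ᵇ⇒< x y)

ER⇔lastLetter : ∀ π → ER π ⇔ T (lastLetter (rises π))
ER⇔lastLetter [] = mk⇔ (λ ()) (λ ())
ER⇔lastLetter (_ ∷ []) = mk⇔ (λ ()) (λ ())
ER⇔lastLetter (x ∷ y ∷ []) = mk⇔ <⇒<ᵇ (<ᵇ⇒< x y)
ER⇔lastLetter (_ ∷ y ∷ z ∷ r) = ER⇔lastLetter (y ∷ z ∷ r)

null-rises⇒¬One : ∀ {π} → null (rises π) ≡ false → ¬ One π
null-rises⇒¬One () refl

null-rises⇒One : ∀ {π} → IsPerm π → π ≢ [] → T (null (rises π)) → One π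
null-rises⇒One {[]} _ π≢[] _ = ⊥-elim (π≢[] refl)
null-rises⇒One {_ ∷ []} π↭ _ _ = cong (_∷ []) (n<1⇒n≡0 (IsPerm⇒<length π↭ (here refl)))
null-rises⇒One {_ ∷ _ ∷ _} _ _ ()

One⇔null : ∀ {π} → IsPerm π → π ≢ [] → One π ⇔ T (null (rises π))
One⇔null π↭ π≢[] = mk⇔ (λ { refl → tt }) (null-rises⇒One π↭ π≢[])

private
  same-bit : ∀ {A B : Set} {a b} → A ⇔ T a → B ⇔ T b → A ⇔ B → a ≡ b
  same-bit A⇔a B⇔b A⇔B = T-injective (B⇔b ⇔-∘ (A⇔B ⇔-∘ ⇔-sym A⇔a))

  same-property : ∀ {A B : Set} {a b} → A ⇔ T a → B ⇔ T b → a ≡ b → A ⇔ B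
  same-property A⇔a B⇔b refl = ⇔-sym B⇔b ⇔-∘ A⇔a

profile-determined : ∀ {α α′} → IsPerm α × α ≢ [] → IsPerm α′ × α′ ≢ [] →
  (∀ j → ALBRER1 j α ⇔ ALBRER1 j α′) → profile (rises α) ≡ profile (rises α′)
profile-determined {α} {α′} (α↭ , α≢[]) (α′↭ , α′≢[]) same =
  ⟨⟩-cong (same-bit (One⇔null α↭ α≢[]) (One⇔null α′↭ α′≢[]) (same (suc (suc (suc zero)))))
          (same-bit (BR⇔firstLetter α) (BR⇔firstLetter α′) (same (suc zero)))
          (same-bit (ER⇔lastLetter α) (ER⇔lastLetter α′) (same (suc (suc zero))))
          (same-bit (AL⇔alternating (IsPerm⇒Linked≢ α↭)) (AL⇔alternating (IsPerm⇒Linked≢ α′↭)) (same zero))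

properties-from-profile : ∀ {π π′} → Linked _≢_ π → Linked _≢_ π′ →
  profile (rises π) ≡ profile (rises π′) → null (rises π) ≡ false →
  ∀ j → ALBRER1 j π ⇔ ALBRER1 j π′
properties-from-profile l l′ eq _ zero =
  same-property (AL⇔alternating l) (AL⇔alternating l′) (cong Profile.alternates eq)
properties-from-profile {π} {π′} _ _ eq _ (suc zero) =
  same-property (BR⇔firstLetter π) (BR⇔firstLetter π′) (cong Profile.first eq)
properties-from-profile {π} {π′} _ _ eq _ (suc (suc zero)) =
  same-property (ER⇔lastLetter π) (ER⇔lastLetter π′) (cong Profile.final eq)
properties-from-profile _ _ eq nonempty (suc (suc (suc zero))) =
  mk⇔ (⊥-elim ∘ null-rises⇒¬One nonempty)
      (⊥-elim ∘ null-rises⇒¬One (trans (sym (cong Profile.isEmpty eq)) nonempty))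

Step : Bool → ℕ → ℕ → Set
Step true x y = x < y
Step false x y = y < x

Step⇒≢ : ∀ {d x y} → Step d x y → x ≢ y
Step⇒≢ {true} x<y = <⇒≢ x<y
Step⇒≢ {false} y<x = ≢-sym (<⇒≢ y<x)

Step⇒<ᵇ : ∀ {d x y} → Step d x y → (x <ᵇ y) ≡ d
Step⇒<ᵇ {true} {x} {y} x<y = dec-true (x <? y) x<y
Step⇒<ᵇ {false} {x} {y} y<x = dec-false (x <? y) (<⇒≯ y<x)

data Border (d : Bool) (xs ys : List ℕ) : Set where
  border : ∀ {x y} → last xs ≡ just x → head ys ≡ just y → Step d x y → Border d xs ys

all-Step⇒Border : ∀ {d xs ys} → xs ≢ [] → ys ≢ [] →
  (∀ {x y} → x ∈ xs → y ∈ ys → Step d x y) → Border d xs ys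
all-Step⇒Border {xs = []} xs≢[] _ _ = ⊥-elim (xs≢[] refl)
all-Step⇒Border {ys = []} _ ys≢[] _ = ⊥-elim (ys≢[] refl)
all-Step⇒Border {xs = x ∷ xs} {ys = _ ∷ _} _ _ step with last-∷ x xs
... | _ , eq , z∈ = border eq refl (step z∈ (here refl))

Chain : ∀ {n} → (Fin (suc n) → List ℕ) → (Fin n → Bool) → Set
Chain G d = ∀ i → Border (d i) (G (inject₁ i)) (G (suc i))

rises-concat : ∀ {n} (G : Fin (suc n) → List ℕ) (d : Fin n → Bool) → Chain G d →
  rises (concat (tabulate G)) ≡ interleave (rises ∘ G) d
rises-concat {zero} G d _ = cong rises (++-identityʳ (G zero))
rises-concat {suc n} G d chain with chain zero
... | border {x} {y} lx hy step = begin
  rises (G zero ++ rest)                  ≡⟨ rises-++ (G zero) rest lx (head-++ (G (suc zero)) _ hy) ⟩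
  rises (G zero) ++ (x <ᵇ y) ∷ rises rest ≡⟨ cong₂ (λ b w → rises (G zero) ++ b ∷ w) (Step⇒<ᵇ step)
                                                  (rises-concat (G ∘ suc) (d ∘ suc) (chain ∘ suc)) ⟩
  interleave (rises ∘ G) d                ∎
  where
  open ≡-Reasoning
  rest = concat (tabulate (G ∘ suc))

Linked-concat : ∀ {n} (G : Fin (suc n) → List ℕ) (d : Fin n → Bool) →
  (∀ i → Linked _≢_ (G i)) → Chain G d → Linked _≢_ (concat (tabulate G))
Linked-concat {zero} G d linked _ = subst (Linked _≢_) (sym (++-identityʳ (G zero))) (linked zero)
Linked-concat {suc n} G d linked chain with chain zero
... | border lx hy step =
  ++⁺ (linked zero)
      (subst₂ (Connected _≢_) (sym lx) (sym (head-++ (G (suc zero)) _ hy)) (just (Step⇒≢ step)))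
      (Linked-concat (G ∘ suc) (d ∘ suc) (linked ∘ suc) (chain ∘ suc))

Blocks : List ℕ → Set
Blocks σ = Fin (length σ) → List ℕ

block : (σ : List ℕ) → Blocks σ → Fin (length σ) → List ℕ
block σ α i = map (_+ offset σ α i) (α i)

inflate≡concat-blocks : ∀ σ α → inflate σ α ≡ concat (tabulate (block σ α))
inflate≡concat-blocks σ α = cong concat (map-tabulate (λ i → i) (block σ α))

inflate-singleton : ∀ s (α : Blocks (s ∷ [])) → inflate (s ∷ []) α ≡ α zero
inflate-singleton s α = begin
  map (_+ offset (s ∷ []) α zero) (α zero) ++ [] ≡⟨ ++-identityʳ _ ⟩
  map (_+ offset (s ∷ []) α zero) (α zero)      ≡⟨ map-cong no-shift (α zero) ⟩
  map (λ v → v) (α zero)                        ≡⟨ map-id (α zero) ⟩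
  α zero                                        ∎
  where
  open ≡-Reasoning
  no-shift : ∀ v → v + offset (s ∷ []) α zero ≡ v
  no-shift v rewrite <ᵇ-irrefl s = +-identityʳ v

sum-map-mono : ∀ {m} (f g : Fin m → ℕ) → (∀ k → f k ≤ g k) → ∀ ks → sum (map f ks) ≤ sum (map g ks)
sum-map-mono f g f≤g [] = z≤n
sum-map-mono f g f≤g (k ∷ ks) = +-mono-≤ (f≤g k) (sum-map-mono f g f≤g ks)

sum-map-gap : ∀ {m} (f g : Fin m → ℕ) → (∀ k → f k ≤ g k) → ∀ {a c ks} → a ∈ ks → c + f a ≤ g a →
  c + sum (map f ks) ≤ sum (map g ks)
sum-map-gap f g f≤g {a} {c} {_ ∷ ks} (here refl) gap =
  subst (_≤ g a + sum (map g ks)) (+-assoc c (f a) (sum (map f ks))) (+-mono-≤ gap (sum-map-mono f g f≤g ks))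
sum-map-gap f g f≤g {c = c} {k ∷ ks} (there a∈) gap =
  subst (_≤ g k + sum (map g ks)) (sym (x∙yz≈y∙xz c (f k) (sum (map f ks)))) (+-mono-≤ (f≤g k) (sum-map-gap f g f≤g a∈ gap))

if-mono : ∀ {p q} n → (T p → T q) → (if p then n else 0) ≤ (if q then n else 0)
if-mono {false} n _ = z≤n
if-mono {true} {true} n _ = ≤-refl
if-mono {true} {false} n p⇒q = ⊥-elim (p⇒q tt)

-- offset σ α b counts the sizes of all blocks below σ(b), in particular the whole block of a.
offset-gap : ∀ σ (α : Blocks σ) {a b} → lookup σ a < lookup σ b → length (α a) + offset σ α a ≤ offset σ α b
offset-gap σ α {a} {b} σa<σb = sum-map-gap (below a) (below b) below-mono (∈-allFin a) gap
  where
  below : Fin (length σ) → Fin (length σ) → ℕ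
  below c k = if lookup σ k <ᵇ lookup σ c then length (α k) else 0
  below-mono : ∀ k → below a k ≤ below b k
  below-mono k = if-mono (length (α k)) (<⇒<ᵇ ∘ (λ σk<σa → <-trans σk<σa σa<σb) ∘ <ᵇ⇒< _ _)
  gap : length (α a) + below a a ≤ below b a
  gap rewrite <ᵇ-irrefl (lookup σ a) | dec-true (lookup σ a <? lookup σ b) σa<σb = ≤-reflexive (+-identityʳ _)

block-<-block : ∀ σ (α : Blocks σ) {a b x y} → IsPerm (α a) → lookup σ a < lookup σ b →
  x ∈ block σ α a → y ∈ block σ α b → x < y
block-<-block σ α {a} {b} αa↭ σa<σb x∈ y∈ with ∈-map⁻ _ x∈ | ∈-map⁻ _ y∈
... | u , u∈ , refl | v , _ , refl = begin-strict
  u + offset σ α a              <⟨ +-monoˡ-< (offset σ α a) (IsPerm⇒<length αa↭ u∈) ⟩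
  length (α a) + offset σ α a   ≤⟨ offset-gap σ α σa<σb ⟩
  offset σ α b                  ≤⟨ m≤n+m (offset σ α b) v ⟩
  v + offset σ α b              ∎
  where open ≤-Reasoning

block-step : ∀ σ (α : Blocks σ) {a b x y} → IsPerm (α a) → IsPerm (α b) → lookup σ a ≢ lookup σ b →
  x ∈ block σ α a → y ∈ block σ α b → Step (lookup σ a <ᵇ lookup σ b) x y
block-step σ α {a} {b} αa↭ αb↭ σa≢σb x∈ y∈ with lookup σ a <ᵇ lookup σ b | <ᵇ-reflects-< (lookup σ a) (lookup σ b)
... | true  | ofʸ σa<σb = block-<-block σ α αa↭ σa<σb x∈ y∈
... | false | ofⁿ σa≮σb = block-<-block σ α αb↭ (≤∧≢⇒< (≮⇒≥ σa≮σb) (≢-sym σa≢σb)) y∈ x∈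

ascent : ∀ s σ → Fin (length σ) → Bool
ascent s σ i = lookup (s ∷ σ) (inject₁ i) <ᵇ lookup (s ∷ σ) (suc i)

module _ {s σ} (σ↭ : IsPerm (s ∷ σ)) (α : Blocks (s ∷ σ)) (α-ok : ∀ i → IsPerm (α i) × α i ≢ []) where

  private
    block≢[] : ∀ i → block (s ∷ σ) α i ≢ []
    block≢[] i = map-≢[] _ (proj₂ (α-ok i))

  blocks-chain : Chain (block (s ∷ σ) α) (ascent s σ)
  blocks-chain i =
    all-Step⇒Border (block≢[] (inject₁ i)) (block≢[] (suc i))
      (block-step (s ∷ σ) α (proj₁ (α-ok _)) (proj₁ (α-ok _)) (Linked-lookup (IsPerm⇒Linked≢ σ↭) i))

  rises-inflate : rises (inflate (s ∷ σ) α) ≡ interleave (rises ∘ block (s ∷ σ) α) (ascent s σ)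
  rises-inflate = trans (cong rises (inflate≡concat-blocks (s ∷ σ) α)) (rises-concat _ _ blocks-chain)

  Linked-inflate : Linked _≢_ (inflate (s ∷ σ) α)
  Linked-inflate =
    subst (Linked _≢_) (sym (inflate≡concat-blocks (s ∷ σ) α))
      (Linked-concat (block (s ∷ σ) α) (ascent s σ) (λ i → Linked≢-shift _ (IsPerm⇒Linked≢ (proj₁ (α-ok i)))) blocks-chain)

mainTheorem1 : QueryComplete ALBRER1
mainTheorem1 [] _ _ _ _ _ _ _ _ = ⇔-id _
mainTheorem1 (s ∷ []) _ _ α α′ _ _ same j =
  subst₂ (λ π π′ → ALBRER1 j π ⇔ ALBRER1 j π′)
    (sym (inflate-singleton s α)) (sym (inflate-singleton s α′)) (same zero j)
mainTheorem1 σ@(s ∷ t ∷ ρ) σ↭ _ α α′ α-ok α′-ok same =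
  properties-from-profile (Linked-inflate σ↭ α α-ok) (Linked-inflate σ↭ α′ α′-ok) same-profile nonempty
  where
  open ≡-Reasoning

  same-block-profile : ∀ i → profile (rises (block σ α i)) ≡ profile (rises (block σ α′ i))
  same-block-profile i = begin
    profile (rises (block σ α i))  ≡⟨ cong profile (rises-shift _ (α i)) ⟩
    profile (rises (α i))          ≡⟨ profile-determined (α-ok i) (α′-ok i) (same i) ⟩
    profile (rises (α′ i))         ≡⟨ cong profile (rises-shift _ (α′ i)) ⟨
    profile (rises (block σ α′ i)) ∎

  same-profile : profile (rises (inflate σ α)) ≡ profile (rises (inflate σ α′))
  same-profile = begin
    profile (rises (inflate σ α))                               ≡⟨ cong profile (rises-inflate σ↭ α α-ok) ⟩
    profile (interleave (rises ∘ block σ α) (ascent s (t ∷ ρ)))  ≡⟨ profile-interleave (ascent s (t ∷ ρ)) same-block-profile ⟩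
    profile (interleave (rises ∘ block σ α′) (ascent s (t ∷ ρ))) ≡⟨ cong profile (rises-inflate σ↭ α′ α′-ok) ⟨
    profile (rises (inflate σ α′))                              ∎

  nonempty : null (rises (inflate σ α)) ≡ false
  nonempty = trans (cong null (rises-inflate σ↭ α α-ok)) (null-++-∷ (rises (block σ α zero)) _ _)
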